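{- In the weighted bin game $(b,M,T)$, suppose Maker adds total weight $w_i$ on his $i$-th turn for each $i=1,\dots,T$. Then the weight in the last remaining live bin at the end of the game is at most \[\sum_{s=1}^T\frac{w_s}{\sum_{t=s}^T b(t)+1}.\]
   Context: Weighted bin game $(b,M,T)$: $T\in\mathbb{N}$ is a constant and $b,M\colon\mathbb{N}\to\mathbb{N}$ are functions. A single player, Maker, plays with $1+\sum_{t=1}^T b(t)$ bins, initially all live and of weight $0$. On turn $t$ ($t=1,\dots,T$) Maker adds (nonnegative, arbitrary real) weight to some bins, and then the $b(t)$ heaviest live bins are killed. After $T$ turns exactly one live bin remains; Maker aims to maximise its weight. Maker's constraint: for every $s>0$, the total weight added during the last $s$ turns is at most $M(s)$.
   Formalization: The weights Maker adds to the bins are nonnegative rationals rather than arbitrary nonnegative reals. -}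

module Defs where

open import Data.Nat as ℕ using (ℕ; zero; suc; _≤?_)
open import Data.Nat.Properties using (_≟_)
open import Data.Bool using (Bool; if_then_else_)
open import Data.Fin using (Fin; zero; suc)
open import Data.Integer using (+_)
open import Data.Rational using (ℚ; 0ℚ; _+_; _*_; _/_; _≤_; _<_)
open import Relation.Nullary.Decidable using (⌊_⌋)
open import Relation.Binary.PropositionalEquality using (_≡_)
open import Data.Product using (Σ; _×_)

sumℕ : (ℕ → ℕ) → ℕ → ℕ → ℕ
sumℕ f s zero    = if ⌊ s ≤? 0 ⌋ then f 0 else 0
sumℕ f s (suc T) = sumℕ f s T ℕ.+ (if ⌊ s ≤? suc T ⌋ then f (suc T) else 0)

sumℚ : (ℕ → ℚ) → ℕ → ℕ → ℚ
sumℚ f s zero    = if ⌊ s ≤? 0 ⌋ then f 0 else 0ℚ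
sumℚ f s (suc T) = sumℚ f s T + (if ⌊ s ≤? suc T ⌋ then f (suc T) else 0ℚ)

sumFin : ∀ {n} → (Fin n → ℚ) → ℚ
sumFin {zero}  f = 0ℚ
sumFin {suc n} f = f zero + sumFin (λ i → f (suc i))

countFin : ∀ {n} → (Fin n → Bool) → ℕ
countFin {zero}  p = 0
countFin {suc n} p = (if p zero then 1 else 0) ℕ.+ countFin (λ i → p (suc i))

nBins : (b : ℕ → ℕ) (T : ℕ) → ℕ
nBins b T = suc (sumℕ b 1 T)

-- A play: add t i = weight added to bin i on turn t (turns 1..T).
-- Weight of bin i after the additions of turns 1..t:
weight : ∀ {n} → (ℕ → Fin n → ℚ) → ℕ → Fin n → ℚ
weight add zero    i = 0ℚ
weight add (suc t) i = weight add t i + add (suc t) i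

totalAdded : ∀ {n} → (ℕ → Fin n → ℚ) → ℕ → ℚ
totalAdded add t = sumFin (add t)

bound : (b : ℕ → ℕ) (T : ℕ) (w : ℕ → ℚ) → ℚ
bound b T w = sumℚ (λ s → w s * (+ 1 / suc (sumℕ b s T))) 1 T

-- A legal play of the weighted bin game (b, M, T).
-- kill i = turn on which bin i is killed; kill i > T means bin i survives.
-- Bin i is live during turn t (when weight is added) iff t ≤ kill i.
record LegalPlay (b M : ℕ → ℕ) (T : ℕ)
                 (add : ℕ → Fin (nBins b T) → ℚ)
                 (kill : Fin (nBins b T) → ℕ) : Set where
  field
    nonneg   : ∀ t i → 1 ℕ.≤ t → t ℕ.≤ T → 0ℚ ≤ add t i
    -- for every s > 0, the total weight added in the last s turns is ≤ M(s)
    budget   : ∀ s → 1 ℕ.≤ s →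
               sumℚ (totalAdded add) (suc (T ℕ.∸ s)) T ≤ (+ M s / 1)
    killCount : ∀ t → 1 ℕ.≤ t → t ℕ.≤ T →
                countFin (λ i → ⌊ kill i ≟ t ⌋) ≡ b t
    -- the killed bins are the heaviest live bins (after turn t's additions):
    -- each bin killed on turn t weighs at least as much as each bin still
    -- live after turn t
    heaviest : ∀ t i j → 1 ℕ.≤ t → t ℕ.≤ T → kill i ≡ t → t ℕ.< kill j →
               weight add t j ≤ weight add t i

module Submission where

-- Let N_t = 1 + Σ_{u=t}^T b(u) be the number of bins live during turn t, and
-- B_t = Σ_{s=1}^t w_s / N_s.  By induction on t, the bins surviving turn t
-- weigh at most N_{t+1} B_t in total: Maker's additions on turn t+1 raise the
-- total of the N_{t+1} live bins to at most N_{t+1} B_t + w_{t+1} = N_{t+1} B_{t+1},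
-- and killing the heaviest of them cannot raise the average weight of the rest.
-- One bin survives turn T, so it weighs at most B_T.

open import Defs
open import Data.Nat using (ℕ; _<_)
open import Data.Fin using (Fin)
open import Data.Rational using (ℚ; _≤_)

open import Algebra.Bundles using (CommutativeMonoid)
import Algebra.Properties.CommutativeSemigroup as CommSemigroupProperties
open import Data.Bool using (Bool; true; false; T; if_then_else_)
open import Data.Empty using (⊥-elim)
open import Data.Fin using (zero; suc)
open import Data.Integer using (+_)
import Data.Integer as ℤ
import Data.Integer.Properties as ℤ
open import Data.Nat using (zero; suc; z≤n; s≤s; _≤?_)
import Data.Nat as ℕ
import Data.Nat.Properties as ℕ
open import Data.Nat.Properties using (_≟_)
open import Data.Rational using (0ℚ; 1ℚ; _+_; _*_; _/_; toℚᵘ)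
import Data.Rational as ℚ
import Data.Rational.Properties as ℚ
import Data.Rational.Unnormalised as ℚᵘ
import Data.Rational.Unnormalised.Properties as ℚᵘ
open import Function using (_∘_)
open import Relation.Binary.PropositionalEquality
open import Relation.Nullary using (yes; no)
open import Relation.Nullary.Decidable using (⌊_⌋; toWitness; fromWitness)

open import Algebra.Properties.Monoid.Mult ℚ.+-0-monoid using (_×_; ×-homo-+)
open CommSemigroupProperties (CommutativeMonoid.commutativeSemigroup ℚ.+-0-commutativeMonoid)
  using (interchange)
open CommSemigroupProperties (CommutativeMonoid.commutativeSemigroup ℚ.*-1-commutativeMonoid)
  using (x∙yz≈y∙xz)

sumFin-cong : ∀ {n} {f g : Fin n → ℚ} → (∀ i → f i ≡ g i) → sumFin f ≡ sumFin g
sumFin-cong {zero}  f≗g = refl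
sumFin-cong {suc n} f≗g = cong₂ _+_ (f≗g zero) (sumFin-cong (f≗g ∘ suc))

sumFin-mono-≤ : ∀ {n} {f g : Fin n → ℚ} → (∀ i → f i ≤ g i) → sumFin f ≤ sumFin g
sumFin-mono-≤ {zero}  f≤g = ℚ.≤-refl
sumFin-mono-≤ {suc n} f≤g = ℚ.+-mono-≤ (f≤g zero) (sumFin-mono-≤ (f≤g ∘ suc))

sumFin-distrib-+ : ∀ {n} (f g : Fin n → ℚ) → sumFin (λ i → f i + g i) ≡ sumFin f + sumFin g
sumFin-distrib-+ {zero}  f g = sym (ℚ.+-identityˡ 0ℚ)
sumFin-distrib-+ {suc n} f g = trans
  (cong (_+_ (f zero + g zero)) (sumFin-distrib-+ (f ∘ suc) (g ∘ suc)))
  (interchange (f zero) (g zero) (sumFin (f ∘ suc)) (sumFin (g ∘ suc)))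

*-distribˡ-sumFin : ∀ {n} c (f : Fin n → ℚ) → sumFin (λ i → c * f i) ≡ c * sumFin f
*-distribˡ-sumFin {zero}  c f = sym (ℚ.*-zeroʳ c)
*-distribˡ-sumFin {suc n} c f = trans
  (cong (_+_ (c * f zero)) (*-distribˡ-sumFin c (f ∘ suc)))
  (sym (ℚ.*-distribˡ-+ c (f zero) (sumFin (f ∘ suc))))

sumFin-nonNeg : ∀ {n} {f : Fin n → ℚ} → (∀ i → 0ℚ ≤ f i) → 0ℚ ≤ sumFin f
sumFin-nonNeg {zero}  f≥0 = ℚ.≤-refl
sumFin-nonNeg {suc n} f≥0 = ℚ.+-mono-≤ (f≥0 zero) (sumFin-nonNeg (f≥0 ∘ suc))

sumFin-lookup : ∀ {n} {f : Fin n → ℚ} → (∀ i → 0ℚ ≤ f i) → ∀ r → f r ≤ sumFin f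
sumFin-lookup {f = f} f≥0 zero = begin
  f zero              ≡⟨ ℚ.+-identityʳ (f zero) ⟨
  f zero + 0ℚ         ≤⟨ ℚ.+-monoʳ-≤ (f zero) (sumFin-nonNeg (f≥0 ∘ suc)) ⟩
  sumFin f            ∎
  where open ℚ.≤-Reasoning
sumFin-lookup {f = f} f≥0 (suc r) = begin
  f (suc r)               ≤⟨ sumFin-lookup (f≥0 ∘ suc) r ⟩
  sumFin (f ∘ suc)        ≡⟨ ℚ.+-identityˡ (sumFin (f ∘ suc)) ⟨
  0ℚ + sumFin (f ∘ suc)   ≤⟨ ℚ.+-monoˡ-≤ (sumFin (f ∘ suc)) (f≥0 zero) ⟩
  sumFin f                ∎
  where open ℚ.≤-Reasoning

masked : ∀ {n} → (Fin n → Bool) → (Fin n → ℚ) → Fin n → ℚ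
masked p f i = if p i then f i else 0ℚ

sumWhere : ∀ {n} → (Fin n → Bool) → (Fin n → ℚ) → ℚ
sumWhere p f = sumFin (masked p f)

sumWhere-mono-≤ : ∀ {n} (p : Fin n → Bool) {f g : Fin n → ℚ} →
                  (∀ i → T (p i) → f i ≤ g i) → sumWhere p f ≤ sumWhere p g
sumWhere-mono-≤ p {f} {g} f≤g = sumFin-mono-≤ masked-≤
  where
  masked-≤ : ∀ i → masked p f i ≤ masked p g i
  masked-≤ i with p i | f≤g i
  ... | true  | fi≤gi = fi≤gi _
  ... | false | _     = ℚ.≤-refl

sumWhere-distrib-+ : ∀ {n} (p : Fin n → Bool) (f g : Fin n → ℚ) →
                     sumWhere p (λ i → f i + g i) ≡ sumWhere p f + sumWhere p g
sumWhere-distrib-+ p f g = trans (sumFin-cong masked-+) (sumFin-distrib-+ (masked p f) (masked p g))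
  where
  masked-+ : ∀ i → masked p (λ j → f j + g j) i ≡ masked p f i + masked p g i
  masked-+ i with p i
  ... | true  = refl
  ... | false = sym (ℚ.+-identityʳ 0ℚ)

*-distribˡ-sumWhere : ∀ {n} (p : Fin n → Bool) c (f : Fin n → ℚ) →
                      sumWhere p (λ i → c * f i) ≡ c * sumWhere p f
*-distribˡ-sumWhere p c f = trans (sumFin-cong masked-*) (*-distribˡ-sumFin c (masked p f))
  where
  masked-* : ∀ i → masked p (λ j → c * f j) i ≡ c * masked p f i
  masked-* i with p i
  ... | true  = refl
  ... | false = sym (ℚ.*-zeroʳ c)

fromℕ : ℕ → ℚ
fromℕ n = n × 1ℚ

sumWhere-const : ∀ {n} (p : Fin n → Bool) c → sumWhere p (λ _ → c) ≡ fromℕ (countFin p) * c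
sumWhere-const {zero}  p c = sym (ℚ.*-zeroˡ c)
sumWhere-const {suc n} p c with p zero
... | true  = begin
  c + sumWhere (p ∘ suc) (λ _ → c)        ≡⟨ cong (_+_ c) (sumWhere-const (p ∘ suc) c) ⟩
  c + k * c                               ≡⟨ cong (_+ k * c) (ℚ.*-identityˡ c) ⟨
  1ℚ * c + k * c                          ≡⟨ ℚ.*-distribʳ-+ c 1ℚ k ⟨
  (1ℚ + k) * c                            ∎
  where
  open ≡-Reasoning
  k = fromℕ (countFin (p ∘ suc))
... | false = trans (ℚ.+-identityˡ _) (sumWhere-const (p ∘ suc) c)

sumWhere≤sumFin : ∀ {n} (p : Fin n → Bool) {f : Fin n → ℚ} →
                  (∀ i → 0ℚ ≤ f i) → sumWhere p f ≤ sumFin f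
sumWhere≤sumFin p {f} f≥0 = sumFin-mono-≤ masked≤
  where
  masked≤ : ∀ i → masked p f i ≤ f i
  masked≤ i with p i
  ... | true  = ℚ.≤-refl
  ... | false = f≥0 i

sumWhere-lookup : ∀ {n} (p : Fin n → Bool) {f : Fin n → ℚ} →
                  (∀ i → 0ℚ ≤ f i) → ∀ {r} → T (p r) → f r ≤ sumWhere p f
sumWhere-lookup p {f} f≥0 {r} pr =
  ℚ.≤-trans (ℚ.≤-reflexive (sym (masked-on pr))) (sumFin-lookup masked≥0 r)
  where
  masked≥0 : ∀ i → 0ℚ ≤ masked p f i
  masked≥0 i with p i
  ... | true  = f≥0 i
  ... | false = ℚ.≤-refl
  masked-on : ∀ {i} → T (p i) → masked p f i ≡ f i
  masked-on {i} pi with p i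
  ... | true = refl

sumWhere-lighter : ∀ {n} (p q : Fin n → Bool) (f : Fin n → ℚ) →
                   (∀ i j → T (p i) → T (q j) → f j ≤ f i) →
                   sumWhere q f * fromℕ (countFin p) ≤ sumWhere p f * fromℕ (countFin q)
sumWhere-lighter p q f q≤p = begin
  sumWhere q f * #p                  ≡⟨ ℚ.*-comm (sumWhere q f) #p ⟩
  #p * sumWhere q f                  ≡⟨ sumWhere-const p (sumWhere q f) ⟨
  sumWhere p (λ _ → sumWhere q f)    ≤⟨ sumWhere-mono-≤ p sumWhere-q≤ ⟩
  sumWhere p (λ i → #q * f i)        ≡⟨ *-distribˡ-sumWhere p #q f ⟩
  #q * sumWhere p f                  ≡⟨ ℚ.*-comm #q (sumWhere p f) ⟩
  sumWhere p f * #q                  ∎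
  where
  open ℚ.≤-Reasoning
  #p = fromℕ (countFin p)
  #q = fromℕ (countFin q)
  sumWhere-q≤ : ∀ i → T (p i) → sumWhere q f ≤ #q * f i
  sumWhere-q≤ i pi = ℚ.≤-trans (sumWhere-mono-≤ q (λ j qj → q≤p i j pi qj))
                               (ℚ.≤-reflexive (sumWhere-const q (f i)))

data Split : Bool → Bool → Bool → Set where
  left  : Split true true false
  right : Split true false true
  none  : Split false false false

Partition : ∀ {n} → (p q r : Fin n → Bool) → Set
Partition p q r = ∀ i → Split (p i) (q i) (r i)

countFin-partition : ∀ {n} {p q r : Fin n → Bool} → Partition p q r →
                     countFin p ≡ countFin q ℕ.+ countFin r
countFin-partition {zero}  split = refl
countFin-partition {suc n} {p} {q} {r} split with p zero | q zero | r zero | split zero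
... | _ | _ | _ | left  = cong suc (countFin-partition (split ∘ suc))
... | _ | _ | _ | right = trans (cong suc (countFin-partition (split ∘ suc)))
                                (sym (ℕ.+-suc (countFin (q ∘ suc)) (countFin (r ∘ suc))))
... | _ | _ | _ | none  = countFin-partition (split ∘ suc)

sumWhere-partition : ∀ {n} {p q r : Fin n → Bool} → Partition p q r →
                     ∀ f → sumWhere p f ≡ sumWhere q f + sumWhere r f
sumWhere-partition {p = p} {q} {r} split f =
  trans (sumFin-cong masked-split) (sumFin-distrib-+ (masked q f) (masked r f))
  where
  masked-split : ∀ i → masked p f i ≡ masked q f i + masked r f i
  masked-split i with p i | q i | r i | split i
  ... | _ | _ | _ | left  = sym (ℚ.+-identityʳ (f i))
  ... | _ | _ | _ | right = sym (ℚ.+-identityˡ (f i))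
  ... | _ | _ | _ | none  = sym (ℚ.+-identityʳ 0ℚ)

sumWhere-lighterPart : ∀ {n} {p q r : Fin n → Bool} → Partition p q r →
                       (f : Fin n → ℚ) → (∀ i j → T (q i) → T (r j) → f j ≤ f i) →
                       sumWhere r f * fromℕ (countFin p) ≤ sumWhere p f * fromℕ (countFin r)
sumWhere-lighterPart {p = p} {q} {r} split f r≤q = begin
  Σr * fromℕ (countFin p)             ≡⟨ cong (λ k → Σr * fromℕ k) (countFin-partition split) ⟩
  Σr * fromℕ (countFin q ℕ.+ countFin r) ≡⟨ cong (Σr *_) (×-homo-+ 1ℚ (countFin q) (countFin r)) ⟩
  Σr * (#q + #r)                      ≡⟨ ℚ.*-distribˡ-+ Σr #q #r ⟩
  Σr * #q + Σr * #r                   ≤⟨ ℚ.+-monoˡ-≤ (Σr * #r) (sumWhere-lighter q r f r≤q) ⟩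
  Σq * #r + Σr * #r                   ≡⟨ ℚ.*-distribʳ-+ #r Σq Σr ⟨
  (Σq + Σr) * #r                      ≡⟨ cong (_* #r) (sumWhere-partition split f) ⟨
  sumWhere p f * #r                   ∎
  where
  open ℚ.≤-Reasoning
  Σq = sumWhere q f
  Σr = sumWhere r f
  #q = fromℕ (countFin q)
  #r = fromℕ (countFin r)

countFin-pos : ∀ {n} (p : Fin n → Bool) {r} → T (p r) → 0 < countFin p
countFin-pos p {zero}  pr with p zero
... | true = s≤s z≤n
countFin-pos p {suc r} pr = ℕ.≤-trans (countFin-pos (p ∘ suc) pr) (ℕ.m≤n+m _ _)

countFin≤ : ∀ {n} (p : Fin n → Bool) → countFin p ℕ.≤ n
countFin≤ {zero}  p = z≤n
countFin≤ {suc n} p with p zero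
... | true  = s≤s (countFin≤ (p ∘ suc))
... | false = ℕ.m≤n⇒m≤1+n (countFin≤ (p ∘ suc))

fromℕ-pos : ∀ {n} → 0 < n → 0ℚ ℚ.< fromℕ n
fromℕ-pos {suc n} _ = ℚ.+-mono-<-≤ (ℚ.positive⁻¹ 1ℚ) (fromℕ-nonNeg n)
  where
  fromℕ-nonNeg : ∀ n → 0ℚ ≤ fromℕ n
  fromℕ-nonNeg zero    = ℚ.≤-refl
  fromℕ-nonNeg (suc n) = ℚ.+-mono-≤ (ℚ.nonNegative⁻¹ 1ℚ) (fromℕ-nonNeg n)

toℚᵘ-fromℕ : ∀ n → toℚᵘ (fromℕ n) ℚᵘ.≃ ℚᵘ.mkℚᵘ (+ n) 0
toℚᵘ-fromℕ zero    = ℚᵘ.≃-refl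
toℚᵘ-fromℕ (suc n) = ℚᵘ.≃-trans (ℚ.toℚᵘ-homo-+ 1ℚ (fromℕ n))
  (ℚᵘ.≃-trans (ℚᵘ.+-congʳ ℚᵘ.1ℚᵘ (toℚᵘ-fromℕ n))
              (ℚᵘ.*≡* (cong (λ x → (+ 1 ℤ.+ x) ℤ.* + 1) (ℤ.*-identityʳ (+ n)))))

fromℕ-*-reciprocal : ∀ k → fromℕ (suc k) * (+ 1 / suc k) ≡ 1ℚ
fromℕ-*-reciprocal k = ℚ.toℚᵘ-injective (begin
  toℚᵘ (fromℕ (suc k) * (+ 1 / suc k))          ≈⟨ ℚ.toℚᵘ-homo-* (fromℕ (suc k)) (+ 1 / suc k) ⟩
  toℚᵘ (fromℕ (suc k)) ℚᵘ.* toℚᵘ (+ 1 / suc k)  ≈⟨ ℚᵘ.*-cong (toℚᵘ-fromℕ (suc k))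
                                                              (ℚ.toℚᵘ-fromℚᵘ (ℚᵘ.1/ n)) ⟩
  n ℚᵘ.* ℚᵘ.1/ n                                ≈⟨ ℚᵘ.*-inverseʳ n ⟩
  ℚᵘ.1ℚᵘ                                        ∎)
  where
  open ℚᵘ.≃-Reasoning
  n = ℚᵘ.mkℚᵘ (+ suc k) 0

sumℕ-empty : ∀ f {s} T → T < s → sumℕ f s T ≡ 0
sumℕ-empty f {s} zero    0<s with s ≤? 0
... | yes s≤0 = ⊥-elim (ℕ.<⇒≱ 0<s s≤0)
... | no  _   = refl
sumℕ-empty f {s} (suc T) 1+T<s with s ≤? suc T
... | yes s≤1+T = ⊥-elim (ℕ.<⇒≱ 1+T<s s≤1+T)
... | no  _     = cong (ℕ._+ 0) (sumℕ-empty f T (ℕ.<-trans (ℕ.n<1+n T) 1+T<s))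

sumℕ-telescope : ∀ (f D : ℕ → ℕ) {s} T →
                 (∀ t → s ℕ.≤ t → t ℕ.≤ T → D t ≡ f t ℕ.+ D (suc t)) →
                 s ℕ.≤ suc T → D s ≡ sumℕ f s T ℕ.+ D (suc T)
sumℕ-telescope f D zero    step z≤n       = step 0 z≤n z≤n
sumℕ-telescope f D zero    step (s≤s z≤n) = refl
sumℕ-telescope f D {s} (suc T) step s≤2+T with s ≤? suc T
... | yes s≤1+T = begin
  D s                                   ≡⟨ sumℕ-telescope f D T step′ s≤1+T ⟩
  S ℕ.+ D (suc T)                       ≡⟨ cong (S ℕ.+_) (step (suc T) s≤1+T ℕ.≤-refl) ⟩
  S ℕ.+ (f (suc T) ℕ.+ D (suc (suc T))) ≡⟨ ℕ.+-assoc S (f (suc T)) _ ⟨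
  S ℕ.+ f (suc T) ℕ.+ D (suc (suc T))   ∎
  where
  open ≡-Reasoning
  S = sumℕ f s T
  step′ : ∀ t → s ℕ.≤ t → t ℕ.≤ T → D t ≡ f t ℕ.+ D (suc t)
  step′ t s≤t t≤T = step t s≤t (ℕ.m≤n⇒m≤1+n t≤T)
... | no s≰1+T with ℕ.≤-antisym s≤2+T (ℕ.≰⇒> s≰1+T)
...   | refl = cong (λ x → x ℕ.+ 0 ℕ.+ D s) (sym (sumℕ-empty f T (ℕ.m<n⇒m<1+n (ℕ.n<1+n T))))

module Game (b M : ℕ → ℕ) (T : ℕ)
            (add : ℕ → Fin (nBins b T) → ℚ) (kill : Fin (nBins b T) → ℕ)
            (play : LegalPlay b M T add kill)
            (survivor : Fin (nBins b T)) (survives : T < kill survivor) where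

  open LegalPlay play

  alive : ℕ → Fin (nBins b T) → Bool
  alive t i = ⌊ t ≤? kill i ⌋

  killedOn : ℕ → Fin (nBins b T) → Bool
  killedOn t i = ⌊ kill i ≟ t ⌋

  aliveCount : ℕ → ℕ
  aliveCount t = countFin (alive t)

  alive-partition : ∀ t → Partition (alive t) (killedOn t) (alive (suc t))
  alive-partition t i with t ≤? kill i | kill i ≟ t | suc t ≤? kill i
  ... | yes _   | yes _    | no _    = left
  ... | yes _   | no _     | yes _   = right
  ... | no _    | no _     | no _    = none
  ... | yes t≤k | no k≢t   | no t≮k  = ⊥-elim (t≮k (ℕ.≤∧≢⇒< t≤k (k≢t ∘ sym)))
  ... | _       | yes refl | yes t<t = ⊥-elim (ℕ.<-irrefl refl t<t)
  ... | no t≰t  | yes refl | _       = ⊥-elim (t≰t ℕ.≤-refl)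
  ... | no t≰k  | _        | yes t<k = ⊥-elim (t≰k (ℕ.<⇒≤ t<k))

  aliveCount-step : ∀ t → 1 ℕ.≤ t → t ℕ.≤ T → aliveCount t ≡ b t ℕ.+ aliveCount (suc t)
  aliveCount-step t 1≤t t≤T =
    trans (countFin-partition (alive-partition t)) (cong (ℕ._+ aliveCount (suc t)) (killCount t 1≤t t≤T))

  aliveCount-telescope : ∀ t → 1 ℕ.≤ t → t ℕ.≤ suc T →
                         aliveCount t ≡ sumℕ b t T ℕ.+ aliveCount (suc T)
  aliveCount-telescope t 1≤t = sumℕ-telescope b aliveCount T
    (λ u t≤u u≤T → aliveCount-step u (ℕ.≤-trans 1≤t t≤u) u≤T)

  aliveCount-pos : ∀ t → t ℕ.≤ suc T → 0 < aliveCount t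
  aliveCount-pos t t≤1+T = countFin-pos (alive t) (fromWitness (ℕ.≤-trans t≤1+T survives))

  aliveCount-last : aliveCount (suc T) ≡ 1
  aliveCount-last =
    ℕ.≤-antisym (ℕ.+-cancelˡ-≤ (sumℕ b 1 T) _ _ all≤nBins) (aliveCount-pos (suc T) ℕ.≤-refl)
    where
    all≤nBins : sumℕ b 1 T ℕ.+ aliveCount (suc T) ℕ.≤ sumℕ b 1 T ℕ.+ 1
    all≤nBins = begin
      sumℕ b 1 T ℕ.+ aliveCount (suc T) ≡⟨ aliveCount-telescope 1 ℕ.≤-refl (s≤s z≤n) ⟨
      aliveCount 1                      ≤⟨ countFin≤ (alive 1) ⟩
      suc (sumℕ b 1 T)                  ≡⟨ ℕ.+-comm 1 (sumℕ b 1 T) ⟩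
      sumℕ b 1 T ℕ.+ 1                  ∎
      where open ℕ.≤-Reasoning

  aliveCount-value : ∀ t → 1 ℕ.≤ t → t ℕ.≤ T → aliveCount t ≡ suc (sumℕ b t T)
  aliveCount-value t 1≤t t≤T = begin
    aliveCount t                       ≡⟨ aliveCount-telescope t 1≤t (ℕ.m≤n⇒m≤1+n t≤T) ⟩
    sumℕ b t T ℕ.+ aliveCount (suc T)  ≡⟨ cong (sumℕ b t T ℕ.+_) aliveCount-last ⟩
    sumℕ b t T ℕ.+ 1                   ≡⟨ ℕ.+-comm (sumℕ b t T) 1 ⟩
    suc (sumℕ b t T)                   ∎
    where open ≡-Reasoning

  weight-nonNeg : ∀ t → t ℕ.≤ T → ∀ i → 0ℚ ≤ weight add t i
  weight-nonNeg zero    _     i = ℚ.≤-refl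
  weight-nonNeg (suc t) 1+t≤T i =
    ℚ.+-mono-≤ (weight-nonNeg t (ℕ.<⇒≤ 1+t≤T) i) (nonneg (suc t) i (s≤s z≤n) 1+t≤T)

  boundTerm : ℕ → ℚ
  boundTerm s = totalAdded add s * (+ 1 / suc (sumℕ b s T))

  partialBound : ℕ → ℚ
  partialBound t = sumℚ boundTerm 1 t

  aliveCount-*-boundTerm : ∀ t → 1 ℕ.≤ t → t ℕ.≤ T →
                           fromℕ (aliveCount t) * boundTerm t ≡ totalAdded add t
  aliveCount-*-boundTerm t 1≤t t≤T rewrite aliveCount-value t 1≤t t≤T = begin
    fromℕ (suc k) * (w * (+ 1 / suc k))   ≡⟨ x∙yz≈y∙xz (fromℕ (suc k)) w (+ 1 / suc k) ⟩
    w * (fromℕ (suc k) * (+ 1 / suc k))   ≡⟨ cong (w *_) (fromℕ-*-reciprocal k) ⟩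
    w * 1ℚ                                ≡⟨ ℚ.*-identityʳ w ⟩
    w                                     ∎
    where
    open ≡-Reasoning
    k = sumℕ b t T
    w = totalAdded add t

  additions-step : ∀ t → t < T →
                   sumWhere (alive (suc t)) (weight add t) ≤ fromℕ (aliveCount (suc t)) * partialBound t →
                   sumWhere (alive (suc t)) (weight add (suc t))
                     ≤ fromℕ (aliveCount (suc t)) * partialBound (suc t)
  additions-step t t<T before = begin
    sumWhere A (weight add (suc t))                 ≡⟨ sumWhere-distrib-+ A (weight add t) (add t′) ⟩
    sumWhere A (weight add t) + sumWhere A (add t′) ≤⟨ ℚ.+-mono-≤ before added≤ ⟩
    N * partialBound t + totalAdded add t′          ≡⟨ cong (_+_ (N * partialBound t)) N*boundTerm ⟨
    N * partialBound t + N * boundTerm t′           ≡⟨ ℚ.*-distribˡ-+ N (partialBound t) (boundTerm t′) ⟨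
    N * partialBound t′                             ∎
    where
    open ℚ.≤-Reasoning
    t′ = suc t
    A = alive t′
    N = fromℕ (aliveCount t′)
    added≤ : sumWhere A (add t′) ≤ totalAdded add t′
    added≤ = sumWhere≤sumFin A (λ i → nonneg t′ i (s≤s z≤n) t<T)
    N*boundTerm : N * boundTerm t′ ≡ totalAdded add t′
    N*boundTerm = aliveCount-*-boundTerm t′ (s≤s z≤n) t<T

  kills-step : ∀ t → 1 ℕ.≤ t → t ℕ.≤ T → ∀ c →
               sumWhere (alive t) (weight add t) ≤ fromℕ (aliveCount t) * c →
               sumWhere (alive (suc t)) (weight add t) ≤ fromℕ (aliveCount (suc t)) * c
  kills-step t 1≤t t≤T c before = ℚ.*-cancelʳ-≤-pos N (begin
    sumWhere (alive (suc t)) W * N  ≤⟨ sumWhere-lighterPart (alive-partition t) W survivor≤killed ⟩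
    sumWhere (alive t) W * R        ≤⟨ ℚ.*-monoʳ-≤-nonNeg R before ⟩
    (N * c) * R                     ≡⟨ ℚ.*-comm (N * c) R ⟩
    R * (N * c)                     ≡⟨ x∙yz≈y∙xz R N c ⟩
    N * (R * c)                     ≡⟨ ℚ.*-comm N (R * c) ⟩
    (R * c) * N                     ∎)
    where
    open ℚ.≤-Reasoning
    W = weight add t
    N = fromℕ (aliveCount t)
    R = fromℕ (aliveCount (suc t))
    survivor≤killed : ∀ i j → Data.Bool.T (killedOn t i) → Data.Bool.T (alive (suc t) j) → W j ≤ W i
    survivor≤killed i j ki aj = heaviest t i j 1≤t t≤T (toWitness ki) (toWitness aj)
    instance
      N-pos : ℚ.Positive N
      N-pos = ℚ.positive (fromℕ-pos (aliveCount-pos t (ℕ.m≤n⇒m≤1+n t≤T)))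
      R-nonNeg : ℚ.NonNegative R
      R-nonNeg = ℚ.nonNegative (ℚ.<⇒≤ (fromℕ-pos (aliveCount-pos (suc t) (s≤s t≤T))))

  survivorsWeight≤ : ∀ t → t ℕ.≤ T →
                     sumWhere (alive (suc t)) (weight add t) ≤ fromℕ (aliveCount (suc t)) * partialBound t
  survivorsWeight≤ zero    _     = ℚ.≤-reflexive (sumWhere-const (alive 1) 0ℚ)
  survivorsWeight≤ (suc t) 1+t≤T = kills-step (suc t) (s≤s z≤n) 1+t≤T (partialBound (suc t))
    (additions-step t 1+t≤T (survivorsWeight≤ t (ℕ.<⇒≤ 1+t≤T)))

  survivor-weight≤ : weight add T survivor ≤ partialBound T
  survivor-weight≤ = begin
    weight add T survivor                  ≤⟨ sumWhere-lookup A (weight-nonNeg T ℕ.≤-refl)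
                                                                (fromWitness survives) ⟩
    sumWhere A (weight add T)              ≤⟨ survivorsWeight≤ T ℕ.≤-refl ⟩
    fromℕ (aliveCount (suc T)) * B         ≡⟨ cong (λ k → fromℕ k * B) aliveCount-last ⟩
    fromℕ 1 * B                            ≡⟨ ℚ.*-identityˡ B ⟩
    B                                      ∎
    where
    open ℚ.≤-Reasoning
    A = alive (suc T)
    B = partialBound T

lemma2 : (b M : ℕ → ℕ) (T : ℕ)
         (add : ℕ → Fin (nBins b T) → ℚ) (kill : Fin (nBins b T) → ℕ) →
         LegalPlay b M T add kill →
         (r : Fin (nBins b T)) → T < kill r →
         weight add T r ≤ bound b T (totalAdded add)
lemma2 b M T add kill play r survives = Game.survivor-weight≤ b M T add kill play r survives
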